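{- The TRIP maps $(e,e,(12))$, $(e,e,(123))$, $(e,(13),(12))$, $(e,(13),(123))$, $((13),e,(12))$, $((13),(13),(12))$, $((13),e,(123))$ and $((13),(13),(123))$ all give the same partition of $\triangle$: for each $n\ge1$, the collections $\{\triangle_{(\sigma,\tau_0,\tau_1)}(i_1,\ldots,i_n):(i_1,\ldots,i_n)\in\{0,1\}^n\}$ coincide for all eight triples $(\sigma,\tau_0,\tau_1)$.
   Context: Let $\triangle=\{(x,y):1>x>y>0\}$; $\pi(x,y,z)=(y/x,z/x)$, and for a $3\times3$ matrix $M$, $\pi(M)$ is the triangle whose vertices are the $\pi$-images of the columns of $M$. $V=\begin{pmatrix}1&1&1\\0&1&1\\0&0&1\end{pmatrix}$, $F_0=\begin{pmatrix}0&0&1\\1&0&0\\0&1&1\end{pmatrix}$, $F_1=\begin{pmatrix}1&0&1\\0&1&0\\0&0&1\end{pmatrix}$. Elements of $S_3$ are identified with permutation matrices: $e=I$, $(12)=\begin{pmatrix}0&1&0\\1&0&0\\0&0&1\end{pmatrix}$, $(13)=\begin{pmatrix}0&0&1\\0&1&0\\1&0&0\end{pmatrix}$, $(23)=\begin{pmatrix}1&0&0\\0&0&1\\0&1&0\end{pmatrix}$, $(123)=\begin{pmatrix}0&1&0\\0&0&1\\1&0&0\end{pmatrix}$, $(132)=\begin{pmatrix}0&0&1\\1&0&0\\0&1&0\end{pmatrix}$. For $(\sigma,\tau_0,\tau_1)\in S_3^3$, $F_i(\sigma,\tau_0,\tau_1)=\sigma F_i\tau_i$ and $\triangle_{(\sigma,\tau_0,\tau_1)}(i_1,\ldots,i_n)=\pi(VF_{i_1}(\sigma,\tau_0,\tau_1)\cdots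 F_{i_n}(\sigma,\tau_0,\tau_1))$. -}

module Defs where

open import Data.Nat using (ℕ; zero; suc; _+_; _*_)
open import Data.Integer using (+_)
open import Data.Rational using (ℚ; _/_; 0ℚ)
open import Data.Fin using (Fin; zero; suc)
open import Data.Vec using (Vec; []; _∷_)
open import Data.List using (List; []; _∷_)
open import Data.List.Membership.Propositional using (_∈_)
open import Data.Product using (_×_; _,_; Σ; ∃)

-- 3×3 matrices with natural-number entries (all matrices in the statement
-- are nonnegative integer matrices), row index first.
Mat : Set
Mat = Fin 3 → Fin 3 → ℕ

mat : ℕ → ℕ → ℕ → ℕ → ℕ → ℕ → ℕ → ℕ → ℕ → Mat
mat a b c d e f g h i zero zero = a
mat a b c d e f g h i zero (suc zero) = b
mat a b c d e f g h i zero (suc (suc zero)) = c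
mat a b c d e f g h i (suc zero) zero = d
mat a b c d e f g h i (suc zero) (suc zero) = e
mat a b c d e f g h i (suc zero) (suc (suc zero)) = f
mat a b c d e f g h i (suc (suc zero)) zero = g
mat a b c d e f g h i (suc (suc zero)) (suc zero) = h
mat a b c d e f g h i (suc (suc zero)) (suc (suc zero)) = i

infixl 7 _·_
_·_ : Mat → Mat → Mat
(A · B) r c = A r zero * B zero c + A r (suc zero) * B (suc zero) c
              + A r (suc (suc zero)) * B (suc (suc zero)) c

I₃ V F₀ F₁ : Mat
I₃ = mat 1 0 0  0 1 0  0 0 1
V  = mat 1 1 1  0 1 1  0 0 1
F₀ = mat 0 0 1  1 0 0  0 1 1
F₁ = mat 1 0 1  0 1 0  0 0 1

data S₃ : Set where
  e p12 p13 p23 p123 p132 : S₃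

perm : S₃ → Mat
perm e    = mat 1 0 0  0 1 0  0 0 1
perm p12  = mat 0 1 0  1 0 0  0 0 1
perm p13  = mat 0 0 1  0 1 0  1 0 0
perm p23  = mat 1 0 0  0 0 1  0 1 0
perm p123 = mat 0 1 0  0 0 1  1 0 0
perm p132 = mat 0 0 1  1 0 0  0 1 0

Triple : Set
Triple = S₃ × S₃ × S₃

Fσ : Triple → Fin 2 → Mat
Fσ (σ , τ₀ , τ₁) zero       = perm σ · F₀ · perm τ₀
Fσ (σ , τ₀ , τ₁) (suc zero) = perm σ · F₁ · perm τ₁

prodF : Triple → {n : ℕ} → Vec (Fin 2) n → Mat
prodF t []       = I₃
prodF t (i ∷ is) = Fσ t i · prodF t is

Point : Set
Point = ℚ × ℚ

-- π(x,y,z) = (y/x, z/x).  For x = 0 (never occurring in the statement,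
-- since all columns considered have positive first coordinate) we return
-- an arbitrary junk value.
π : ℕ → ℕ → ℕ → Point
π zero    y z = 0ℚ , 0ℚ
π (suc x) y z = (+ y / suc x) , (+ z / suc x)

column : Mat → Fin 3 → Point
column M c = π (M zero c) (M (suc zero) c) (M (suc (suc zero)) c)

Triangle : Set
Triangle = List Point

πM : Mat → Triangle
πM M = column M zero ∷ column M (suc zero) ∷ column M (suc (suc zero)) ∷ []

_≈△_ : Triangle → Triangle → Set
T ≈△ U = (∀ {p} → p ∈ T → p ∈ U) × (∀ {p} → p ∈ U → p ∈ T)

tri : Triple → {n : ℕ} → Vec (Fin 2) n → Triangle
tri t is = πM (V · prodF t is)

SameCollection : Triple → Triple → ℕ → Set
SameCollection t u n =
  (∀ (w : Vec (Fin 2) n) → ∃ λ (w' : Vec (Fin 2) n) → tri t w ≈△ tri u w')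
  × (∀ (w' : Vec (Fin 2) n) → ∃ λ (w : Vec (Fin 2) n) → tri t w ≈△ tri u w')

eightTriples : List Triple
eightTriples =
  (e , e , p12) ∷ (e , e , p123) ∷ (e , p13 , p12) ∷ (e , p13 , p123) ∷
  (p13 , e , p12) ∷ (p13 , p13 , p12) ∷ (p13 , e , p123) ∷ (p13 , p13 , p123) ∷ []

{-# OPTIONS --safe #-}
module Submission where

open import Defs
open import Data.Bool using (Bool; false; true; _xor_)
open import Data.Nat using (ℕ; _≥_; _+_; _*_; zero; suc)
open import Data.Nat.Properties using (_≟_)
open import Data.Nat.Tactic.RingSolver using (solve-∀)
open import Data.Fin using (Fin; zero; suc; opposite)
open import Data.Fin.Properties using (all?; opposite-involutive)
open import Data.Vec using (Vec; []; _∷_)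
open import Data.List.Membership.Propositional using (_∈_)
open import Data.List.Relation.Unary.Any using (here; there)
open import Data.Product using (∃; _,_)
open import Function using (_$_)
open import Relation.Binary.Bundles using (Setoid)
open import Relation.Binary.PropositionalEquality
  using (_≡_; refl; sym; trans; cong; cong₂; subst)
open import Relation.Nullary using (Dec)
open import Relation.Nullary.Decidable using (True; toWitness; map′)

-- Right multiplication acts on columns, and π(M) only sees the set of columns
-- of M.  For the eight triples, F_i(σ,τ₀,τ₁) is, up to the column reversal
-- J = (13) on the right, one of the two branch maps F₀ and F₁·(12), because
-- (123) = (12)(13); and σ = (13) merely exchanges the two branches, because
-- (13)·F₀ = F₁·(12).  So, given a word for one triple, a word for another is
-- built letter by letter, keeping the two partial products equal up to
-- reversing their columns, and the resulting triangles coincide.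

infix 4 _≈_ _∼_

record _≈_ (M N : Mat) : Set where
  constructor entrywise
  field entry : ∀ r c → M r c ≡ N r c
open _≈_

≈-refl : ∀ {M} → M ≈ M
≈-refl = entrywise λ r c → refl

≈-sym : ∀ {M N} → M ≈ N → N ≈ M
≈-sym M≈N = entrywise λ r c → sym (entry M≈N r c)

≈-trans : ∀ {M N P} → M ≈ N → N ≈ P → M ≈ P
≈-trans M≈N N≈P = entrywise λ r c → trans (entry M≈N r c) (entry N≈P r c)

≈-setoid : Setoid _ _
≈-setoid = record
  { Carrier = Mat ; _≈_ = _≈_
  ; isEquivalence = record { refl = ≈-refl ; sym = ≈-sym ; trans = ≈-trans } }

_≈?_ : (M N : Mat) → Dec (M ≈ N)
M ≈? N = map′ entrywise entry (all? λ r → all? λ c → M r c ≟ N r c)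

≈-decide : ∀ {M N} {M≈N : True (M ≈? N)} → M ≈ N
≈-decide {M≈N = M≈N} = toWitness M≈N

·-congˡ : ∀ {M N} P → M ≈ N → M · P ≈ N · P
·-congˡ {M} {N} P (entrywise M≈N) = entrywise λ r c →
  cong₂ _+_ (cong₂ _+_ (cong (_* P zero c) (M≈N r zero)) (cong (_* P (suc zero) c) (M≈N r (suc zero))))
            (cong (_* P (suc (suc zero)) c) (M≈N r (suc (suc zero))))

·-congʳ : ∀ M {N P} → N ≈ P → M · N ≈ M · P
·-congʳ M {N} {P} (entrywise N≈P) = entrywise λ r c →
  cong₂ _+_ (cong₂ _+_ (cong (M r zero *_) (N≈P zero c)) (cong (M r (suc zero) *_) (N≈P (suc zero) c)))
            (cong (M r (suc (suc zero)) *_) (N≈P (suc (suc zero)) c))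

·-assoc : ∀ M N P → M · (N · P) ≈ (M · N) · P
·-assoc M N P = entrywise λ r c → dot-assoc (M r zero) (M r (suc zero)) (M r (suc (suc zero)))
  (N zero zero) (N zero (suc zero)) (N zero (suc (suc zero)))
  (N (suc zero) zero) (N (suc zero) (suc zero)) (N (suc zero) (suc (suc zero)))
  (N (suc (suc zero)) zero) (N (suc (suc zero)) (suc zero)) (N (suc (suc zero)) (suc (suc zero)))
  (P zero c) (P (suc zero) c) (P (suc (suc zero)) c)
  where
  dot-assoc : ∀ x₀ x₁ x₂ a₀₀ a₀₁ a₀₂ a₁₀ a₁₁ a₁₂ a₂₀ a₂₁ a₂₂ y₀ y₁ y₂ →
    x₀ * (a₀₀ * y₀ + a₀₁ * y₁ + a₀₂ * y₂) + x₁ * (a₁₀ * y₀ + a₁₁ * y₁ + a₁₂ * y₂)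
      + x₂ * (a₂₀ * y₀ + a₂₁ * y₁ + a₂₂ * y₂)
    ≡ (x₀ * a₀₀ + x₁ * a₁₀ + x₂ * a₂₀) * y₀ + (x₀ * a₀₁ + x₁ * a₁₁ + x₂ * a₂₁) * y₁
      + (x₀ * a₀₂ + x₁ * a₁₂ + x₂ * a₂₂) * y₂
  dot-assoc = solve-∀

select₀ : ∀ x y z → x * 1 + y * 0 + z * 0 ≡ x
select₀ = solve-∀

select₁ : ∀ x y z → x * 0 + y * 1 + z * 0 ≡ y
select₁ = solve-∀

select₂ : ∀ x y z → x * 0 + y * 0 + z * 1 ≡ z
select₂ = solve-∀

·-identityʳ : ∀ M → M · I₃ ≈ M
·-identityʳ M = entrywise identity-entry
  where
  identity-entry : ∀ r c → (M · I₃) r c ≡ M r c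
  identity-entry r zero             = select₀ (M r zero) (M r (suc zero)) (M r (suc (suc zero)))
  identity-entry r (suc zero)       = select₁ (M r zero) (M r (suc zero)) (M r (suc (suc zero)))
  identity-entry r (suc (suc zero)) = select₂ (M r zero) (M r (suc zero)) (M r (suc (suc zero)))

·-reverseColumns : ∀ M r c → (M · perm p13) r c ≡ M r (opposite c)
·-reverseColumns M r zero             = select₂ (M r zero) (M r (suc zero)) (M r (suc (suc zero)))
·-reverseColumns M r (suc zero)       = select₁ (M r zero) (M r (suc zero)) (M r (suc (suc zero)))
·-reverseColumns M r (suc (suc zero)) = select₀ (M r zero) (M r (suc zero)) (M r (suc (suc zero)))

rev : Bool → S₃
rev false = e
rev true  = p13

J^ : Bool → Mat
J^ b = perm (rev b)

J^-xor : ∀ a b → J^ a · J^ b ≈ J^ (a xor b)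
J^-xor false false = ≈-decide
J^-xor false true  = ≈-decide
J^-xor true  false = ≈-decide
J^-xor true  true  = ≈-decide

J^-involutive : ∀ b → J^ b · J^ b ≈ I₃
J^-involutive false = ≈-decide
J^-involutive true  = ≈-decide

data _∼_ (M N : Mat) : Set where
  up-to-J^ : ∀ b → M ≈ N · J^ b → M ∼ N

≈⇒∼ : ∀ {M N} → M ≈ N → M ∼ N
≈⇒∼ {N = N} M≈N = up-to-J^ false $ ≈-trans M≈N (≈-sym (·-identityʳ N))

∼-sym : ∀ {M N} → M ∼ N → N ∼ M
∼-sym {M} {N} (up-to-J^ b M≈NJ) = up-to-J^ b $ ≈-sym $ begin
  M · J^ b            ≈⟨ ·-congˡ (J^ b) M≈NJ ⟩
  N · J^ b · J^ b     ≈⟨ ·-assoc N (J^ b) (J^ b) ⟨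
  N · (J^ b · J^ b)   ≈⟨ ·-congʳ N (J^-involutive b) ⟩
  N · I₃              ≈⟨ ·-identityʳ N ⟩
  N                   ∎
  where open import Relation.Binary.Reasoning.Setoid ≈-setoid

∼-trans : ∀ {M N P} → M ∼ N → N ∼ P → M ∼ P
∼-trans {M} {N} {P} (up-to-J^ a M≈NJa) (up-to-J^ b N≈PJb) = up-to-J^ (b xor a) $
  ≈-trans M≈NJa (≈-trans (·-congˡ (J^ a) N≈PJb)
    (≈-trans (≈-sym (·-assoc P (J^ b) (J^ a))) (·-congʳ P (J^-xor b a))))

∼-·ˡ : ∀ X {M N} → M ∼ N → X · M ∼ X · N
∼-·ˡ X {N = N} (up-to-J^ b M≈NJ) = up-to-J^ b $ ≈-trans (·-congʳ X M≈NJ) (·-assoc X N (J^ b))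

∼-setoid : Setoid _ _
∼-setoid = record
  { Carrier = Mat ; _≈_ = _∼_
  ; isEquivalence = record { refl = ≈⇒∼ ≈-refl ; sym = ∼-sym ; trans = ∼-trans } }

-- As column operations, F₀ sends (a, b, c) to (b, c, a + c) and F₁·(12) sends it to (b, a, a + c).

branch : Fin 2 → Mat
branch zero       = F₀
branch (suc zero) = F₁ · perm p12

swapIf : Bool → Fin 2 → Fin 2
swapIf false i = i
swapIf true  i = opposite i

swapIf-involutive : ∀ s i → swapIf s (swapIf s i) ≡ i
swapIf-involutive false i = refl
swapIf-involutive true  i = opposite-involutive i

J^-branch : ∀ s i → J^ s · branch i ≈ branch (swapIf s i)
J^-branch false zero       = ≈-decide
J^-branch false (suc zero) = ≈-decide
J^-branch true  zero       = ≈-decide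
J^-branch true  (suc zero) = ≈-decide

τ₁ : Bool → S₃
τ₁ false = p12
τ₁ true  = p123

perm-τ₁ : ∀ b → perm (τ₁ b) ≈ perm p12 · J^ b
perm-τ₁ false = ≈-decide
perm-τ₁ true  = ≈-decide

data Family : Triple → Set where
  family : ∀ s b₀ b₁ → Family (rev s , rev b₀ , τ₁ b₁)

eightTriples⊆Family : ∀ {t} → t ∈ eightTriples → Family t
eightTriples⊆Family (here refl)                                                         = family false false false
eightTriples⊆Family (there (here refl))                                                 = family false false true
eightTriples⊆Family (there (there (here refl)))                                         = family false true  false
eightTriples⊆Family (there (there (there (here refl))))                                 = family false true  true
eightTriples⊆Family (there (there (there (there (here refl)))))                         = family true  false false
eightTriples⊆Family (there (there (there (there (there (here refl))))))                 = family true  true  false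
eightTriples⊆Family (there (there (there (there (there (there (here refl)))))))         = family true false true
eightTriples⊆Family (there (there (there (there (there (there (there (here refl)))))))) = family true true true

Fσ-∼-branch : ∀ s b₀ b₁ i → Fσ (rev s , rev b₀ , τ₁ b₁) i ∼ branch (swapIf s i)
Fσ-∼-branch s b₀ b₁ zero       = up-to-J^ b₀ $ ·-congˡ (J^ b₀) (J^-branch s zero)
Fσ-∼-branch s b₀ b₁ (suc zero) = up-to-J^ b₁ (begin
  J^ s · F₁ · perm (τ₁ b₁)         ≈⟨ ·-congʳ (J^ s · F₁) (perm-τ₁ b₁) ⟩
  J^ s · F₁ · (perm p12 · J^ b₁)   ≈⟨ ·-assoc (J^ s · F₁) (perm p12) (J^ b₁) ⟩
  J^ s · F₁ · perm p12 · J^ b₁     ≈⟨ ·-congˡ (J^ b₁) (≈-sym (·-assoc (J^ s) F₁ (perm p12))) ⟩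
  J^ s · branch (suc zero) · J^ b₁ ≈⟨ ·-congˡ (J^ b₁) (J^-branch s (suc zero)) ⟩
  branch (swapIf s (suc zero)) · J^ b₁ ∎)
  where open import Relation.Binary.Reasoning.Setoid ≈-setoid

step-∼ : ∀ {t u X Y} → Family t → Family u → X ∼ Y → ∀ i → ∃ λ i′ → X · Fσ t i ∼ Y · Fσ u i′
step-∼ {t} {u} {X} {Y} (family s b₀ b₁) (family s′ c₀ c₁) (up-to-J^ a X≈YJ) i = i′ , (begin
  X · Fσ t i                       ≈⟨ ∼-·ˡ X (Fσ-∼-branch s b₀ b₁ i) ⟩
  X · branch (swapIf s i)          ≈⟨ ≈⇒∼ (·-congˡ (branch (swapIf s i)) X≈YJ) ⟩
  Y · J^ a · branch (swapIf s i)   ≈⟨ ≈⇒∼ (·-assoc Y (J^ a) (branch (swapIf s i))) ⟨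
  Y · (J^ a · branch (swapIf s i)) ≈⟨ ≈⇒∼ (·-congʳ Y (J^-branch a (swapIf s i))) ⟩
  Y · branch k                     ≡⟨ cong (λ k → Y · branch k) (swapIf-involutive s′ k) ⟨
  Y · branch (swapIf s′ i′)        ≈⟨ ∼-·ˡ Y (Fσ-∼-branch s′ c₀ c₁ i′) ⟨
  Y · Fσ u i′                      ∎)
  where
  open import Relation.Binary.Reasoning.Setoid ∼-setoid
  -- i′ is the letter whose branch, after σ′ = (13)^s′ acts, is the branch k reached by X.
  k  = swapIf a (swapIf s i)
  i′ = swapIf s′ k

prodF-∼ : ∀ {t u X Y} → Family t → Family u → X ∼ Y →
          ∀ {n} (w : Vec (Fin 2) n) → ∃ λ (w′ : Vec (Fin 2) n) → X · prodF t w ∼ Y · prodF u w′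
prodF-∼ {X = X} {Y} _ _ X∼Y [] = [] , (begin
  X · I₃ ≈⟨ ≈⇒∼ (·-identityʳ X) ⟩
  X      ≈⟨ X∼Y ⟩
  Y      ≈⟨ ≈⇒∼ (·-identityʳ Y) ⟨
  Y · I₃ ∎)
  where open import Relation.Binary.Reasoning.Setoid ∼-setoid
prodF-∼ {t} {u} {X} {Y} ht hu X∼Y (i ∷ w) with step-∼ ht hu X∼Y i
... | i′ , XF∼YF with prodF-∼ ht hu XF∼YF w
... | w′ , XFP∼YFP = i′ ∷ w′ , (begin
  X · (Fσ t i · prodF t w)   ≈⟨ ≈⇒∼ (·-assoc X (Fσ t i) (prodF t w)) ⟩
  X · Fσ t i · prodF t w     ≈⟨ XFP∼YFP ⟩
  Y · Fσ u i′ · prodF u w′   ≈⟨ ≈⇒∼ (·-assoc Y (Fσ u i′) (prodF u w′)) ⟨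
  Y · (Fσ u i′ · prodF u w′) ∎)
  where open import Relation.Binary.Reasoning.Setoid ∼-setoid

column-cong : ∀ M N {c c′} → (∀ r → M r c ≡ N r c′) → column M c ≡ column N c′
column-cong M N eq
  rewrite eq zero | eq (suc zero) | eq (suc (suc zero)) = refl

column-∼ : ∀ {M N} → M ∼ N → ∀ c → ∃ λ c′ → column M c ≡ column N c′
column-∼ {M} {N} (up-to-J^ false M≈N) c =
  c , column-cong M N λ r → trans (entry M≈N r c) (entry (·-identityʳ N) r c)
column-∼ {M} {N} (up-to-J^ true M≈N) c =
  opposite c , column-cong M N λ r → trans (entry M≈N r c) (·-reverseColumns N r c)

∈πM⁻ : ∀ {M p} → p ∈ πM M → ∃ λ c → p ≡ column M c
∈πM⁻ (here eq)                 = zero , eq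
∈πM⁻ (there (here eq))         = suc zero , eq
∈πM⁻ (there (there (here eq))) = suc (suc zero) , eq
∈πM⁻ (there (there (there ())))

∈πM⁺ : ∀ {M} c → column M c ∈ πM M
∈πM⁺ zero             = here refl
∈πM⁺ (suc zero)       = there (here refl)
∈πM⁺ (suc (suc zero)) = there (there (here refl))

πM-⊆ : ∀ {M N} → (∀ c → ∃ λ c′ → column M c ≡ column N c′) → ∀ {p} → p ∈ πM M → p ∈ πM N
πM-⊆ {M} {N} cols p∈ with ∈πM⁻ {M} p∈
... | c , p≡ with cols c
... | c′ , eq = subst (_∈ πM N) (sym (trans p≡ eq)) (∈πM⁺ {N} c′)

∼⇒≈△ : ∀ {M N} → M ∼ N → πM M ≈△ πM N
∼⇒≈△ {M} {N} M∼N = πM-⊆ {M} {N} (column-∼ M∼N) , πM-⊆ {N} {M} (column-∼ (∼-sym M∼N))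

mainTheorem6 : ∀ (n : ℕ) → n ≥ 1 → ∀ {t u : Triple} → t ∈ eightTriples → u ∈ eightTriples →
    SameCollection t u n
mainTheorem6 n _ {t} {u} t∈ u∈ = forward , backward
  where
  ht = eightTriples⊆Family t∈
  hu = eightTriples⊆Family u∈
  forward : ∀ (w : Vec (Fin 2) n) → ∃ λ (w′ : Vec (Fin 2) n) → tri t w ≈△ tri u w′
  forward w with prodF-∼ {X = V} {V} ht hu (≈⇒∼ ≈-refl) w
  ... | w′ , h = w′ , ∼⇒≈△ h
  backward : ∀ (w′ : Vec (Fin 2) n) → ∃ λ (w : Vec (Fin 2) n) → tri t w ≈△ tri u w′
  backward w′ with prodF-∼ {X = V} {V} hu ht (≈⇒∼ ≈-refl) w′
  ... | w , h = w , ∼⇒≈△ (∼-sym h)
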